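{- Let $p(j)=\binom{j+4}{4}$. The largest positive integer $n$ that cannot be written as $n=\sum_{j\in S}\binom{j+4}{4}$ for some finite set $S$ of integers $j\ge 0$ is $12659$. In other words, $12659$ has no such representation, and every integer $n>12659$ has one.
   Context: A representation of $n$ as a sum of distinct values of $p(j)$ with $j\ge j_0$ means a finite set $S$ of integers, each $\ge j_0$, such that $n=\sum_{j\in S}p(j)$. Since each index is used at most once and $p$ is injective on $j\ge 0$, the summands are distinct values. Here $j_0=0$. -}

module Defs where

open import Data.Nat using (ℕ; _+_)
open import Data.Nat.Combinatorics using (_C_)
open import Data.List using (List; map)
open import Data.Nat.ListAction using (sum)
open import Data.List.Relation.Unary.Unique.Propositional using (Unique)
open import Data.Product using (Σ; _×_)
open import Relation.Binary.PropositionalEquality using (_≡_)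

p : ℕ → ℕ
p j = (j + 4) C 4

Representable : ℕ → Set
Representable n = Σ (List ℕ) (λ S → Unique S × sum (map p S) ≡ n)

-- Richert's method. By Pascal's rule p (k + 1) = p k + C(k + 4, 3), and C(k + 4, 3) ≤ p k
-- once k ≥ 3, so p (k + 1) ≤ 2 p k. Hence if every n in (M, M + p k] is a sum of distinct
-- p j with j < k, then every n in (M, M + p (k + 1)] is a sum of distinct p j with j ≤ k:
-- the larger ones are p k plus a number from the previous interval. For M = 12659 and
-- k = 21 the interval is checked by a pruned exhaustive search, and induction on k covers
-- every n > 12659. The same search, proved complete, finds no representation of 12659,
-- which could only use the p j < 12659, i.e. j < 22.

module Submission where

open import Defs
open import Data.Nat using (ℕ; _>_)
open import Data.Product using (_×_)
open import Relation.Nullary using (¬_)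

open import Data.Nat.Properties
open import Algebra.Properties.CommutativeSemigroup +-commutativeSemigroup using (x∙yz≈y∙xz)
open import Data.Bool using (Bool; T; _∧_; _∨_)
open import Data.Bool.Properties using (T-∧; T-∨)
open import Data.List using (List; []; _∷_; map; downFrom; applyDownFrom)
open import Data.List.Membership.Propositional using (_∈_; _∉_)
open import Data.List.Membership.DecPropositional _≟_ using (_∈?_)
open import Data.List.Relation.Binary.Subset.Propositional using (_⊆_)
open import Data.List.Relation.Binary.Subset.Propositional.Properties using (xs⊆x∷xs; ∷⁺ʳ)
open import Data.List.Relation.Unary.All as All using (All; []; _∷_; all?)
open import Data.List.Relation.Unary.All.Properties using (All¬⇒¬Any; anti-mono)
open import Data.List.Relation.Unary.Any using (here; there)
open import Data.List.Relation.Unary.Any.Properties using (applyDownFrom⁺)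
open import Data.List.Relation.Unary.AllPairs using ([]; _∷_)
open import Data.List.Relation.Unary.Unique.Propositional using (Unique)
open import Data.Nat using (zero; suc; _+_; _*_; _∸_; _≤_; _<_; _≤ᵇ_; _≡ᵇ_; z≤n; s≤s; s≤s⁻¹)
open import Data.Nat.Combinatorics using (_C_; nC1≡n; nCk≡nC[n∸k]; nCk+nC[k+1]≡[n+1]C[k+1])
open import Data.Nat.ListAction using (sum)
open import Data.Product using (Σ; ∃-syntax; _,_; proj₂)
open import Data.Sum using (_⊎_; inj₁; inj₂)
open import Function using (_∘_; Equivalence)
open import Relation.Binary.PropositionalEquality
open import Relation.Nullary.Decidable using (yes; no; toWitness; T?)

nCk>0 : ∀ {n k} → k ≤ n → 0 < n C k
nCk>0 {n} {zero} _ = s≤s z≤n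
nCk>0 {suc n} {suc k} (s≤s k≤n) =
  subst (0 <_) (nCk+nC[k+1]≡[n+1]C[k+1] n k) (<-≤-trans (nCk>0 k≤n) (m≤m+n _ _))

-- Below the middle the binomial coefficients increase: at the middle this is
-- the symmetry of n C k, and further out it is inherited through Pascal's rule.
nCk≤nC[1+k] : ∀ {n k} → 2 * k < n → n C k ≤ n C suc k
nCk≤nC[1+k] {suc n} {zero} _ = subst (1 ≤_) (sym (nC1≡n (suc n))) (s≤s z≤n)
nCk≤nC[1+k] {suc n} {suc k} 2k+2<n+1 with m≤n⇒m<n∨m≡n (s≤s⁻¹ 2k+2<n+1)
... | inj₁ 2k+2<n = begin
  suc n C suc k           ≡⟨ nCk+nC[k+1]≡[n+1]C[k+1] n k ⟨
  n C k + n C suc k       ≤⟨ +-mono-≤ (nCk≤nC[1+k] 2k<n) (nCk≤nC[1+k] 2k+2<n) ⟩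
  n C suc k + n C suc (suc k) ≡⟨ nCk+nC[k+1]≡[n+1]C[k+1] n (suc k) ⟩
  suc n C suc (suc k)       ∎
  where
  open ≤-Reasoning
  2k<n : 2 * k < n
  2k<n = <-trans (*-monoʳ-< 2 (n<1+n k)) 2k+2<n
... | inj₂ refl = ≤-reflexive (begin
  suc n C suc k     ≡⟨ nCk≡nC[n∸k] (s≤s (≤-trans (n≤1+n k) (m≤m+n (suc k) _))) ⟩
  suc n C (n ∸ k)   ≡⟨ cong ((suc n C_) ∘ (_∸ k)) 2[1+k]≡k+[2+k] ⟩
  suc n C (k + suc (suc k) ∸ k) ≡⟨ cong (suc n C_) (m+n∸m≡n k (suc (suc k))) ⟩
  suc n C suc (suc k) ∎)
  where
  open ≡-Reasoning
  2[1+k]≡k+[2+k] : 2 * suc k ≡ k + suc (suc k)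
  2[1+k]≡k+[2+k] = trans (cong (λ m → suc (k + suc m)) (+-identityʳ k)) (sym (+-suc k (suc k)))

p-suc : ∀ k → p (suc k) ≡ (k + 4) C 3 + p k
p-suc k = sym (nCk+nC[k+1]≡[n+1]C[k+1] (k + 4) 3)

p<p[1+k] : ∀ k → p k < p (suc k)
p<p[1+k] k = subst (p k <_) (trans (+-comm (p k) _) (sym (p-suc k)))
  (m<m+n (p k) (nCk>0 (≤-trans (n≤1+n 3) (m≤n+m 4 k))))

p-mono-≤ : ∀ {i j} → i ≤ j → p i ≤ p j
p-mono-≤ {j = zero} z≤n = ≤-refl
p-mono-≤ {i} {suc j} i≤1+j with m≤n⇒m<n∨m≡n i≤1+j
... | inj₁ (s≤s i≤j) = ≤-trans (p-mono-≤ i≤j) (<⇒≤ (p<p[1+k] j))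
... | inj₂ refl = ≤-refl

n≤p[n] : ∀ n → n ≤ p n
n≤p[n] zero = z≤n
n≤p[n] (suc n) = <-≤-trans (s≤s (n≤p[n] n)) (p<p[1+k] n)

p[1+k]≤p[k]+p[k] : ∀ {k} → 3 ≤ k → p (suc k) ≤ p k + p k
p[1+k]≤p[k]+p[k] {k} 3≤k = subst (_≤ p k + p k) (sym (p-suc k))
  (+-monoˡ-≤ (p k) (nCk≤nC[1+k] (+-monoˡ-≤ 4 3≤k)))

Unique-remove : ∀ {A : Set} (f : A → ℕ) {x : A} {xs : List A} → Unique xs → x ∈ xs →
  ∃[ ys ] (Unique ys × x ∉ ys × ys ⊆ xs × sum (map f xs) ≡ f x + sum (map f ys))
Unique-remove f {xs = x ∷ ys} (x∉ys ∷ ys!) (here refl) =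
  ys , ys! , All¬⇒¬Any x∉ys , xs⊆x∷xs ys x , refl
Unique-remove f {x} {y ∷ ys} (y∉ys ∷ ys!) (there x∈ys)
  with zs , zs! , x∉zs , zs⊆ys , sum≡ ← Unique-remove f ys! x∈ys =
  y ∷ zs , anti-mono zs⊆ys y∉ys ∷ zs! , x∉y∷zs , ∷⁺ʳ y zs⊆ys ,
  trans (cong (f y +_) sum≡) (x∙yz≈y∙xz (f y) (f x) _)
  where
  x∉y∷zs : x ∉ y ∷ zs
  x∉y∷zs (here x≡y) = All.lookup y∉ys x∈ys (sym x≡y)
  x∉y∷zs (there x∈zs) = x∉zs x∈zs

RepresentableBelow : ℕ → ℕ → Set
RepresentableBelow k n = Σ (List ℕ) (λ S → Unique S × All (_< k) S × sum (map p S) ≡ n)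

representableBelow⇒representable : ∀ {k n} → RepresentableBelow k n → Representable n
representableBelow⇒representable (S , S! , _ , sum≡) = S , S! , sum≡

representableBelow-mono : ∀ {k l n} → k ≤ l → RepresentableBelow k n → RepresentableBelow l n
representableBelow-mono k≤l (S , S! , S<k , sum≡) =
  S , S! , All.map (λ x<k → <-≤-trans x<k k≤l) S<k , sum≡

representableBelow-suc⁺ : ∀ {k m} → RepresentableBelow k m →
  RepresentableBelow (suc k) (p k + m)
representableBelow-suc⁺ {k} (S , S! , S<k , sum≡) =
  k ∷ S , All.map (≢-sym ∘ <⇒≢) S<k ∷ S! , ≤-refl ∷ All.map m<n⇒m<1+n S<k ,
  cong (p k +_) sum≡

All<suc∧∉⇒All< : ∀ {k S} → All (_< suc k) S → k ∉ S → All (_< k) S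
All<suc∧∉⇒All< {k} {S} S<1+k k∉S = All.tabulate λ {x} x∈S →
  ≤∧≢⇒< (s≤s⁻¹ (All.lookup S<1+k x∈S)) (λ x≡k → k∉S (subst (_∈ S) x≡k x∈S))

representableBelow-suc⁻ : ∀ {k n} → RepresentableBelow (suc k) n →
  RepresentableBelow k n ⊎ ∃[ m ] (p k + m ≡ n × RepresentableBelow k m)
representableBelow-suc⁻ {k} (S , S! , S<1+k , sum≡) with k ∈? S
... | no k∉S = inj₁ (S , S! , All<suc∧∉⇒All< S<1+k k∉S , sum≡)
... | yes k∈S with S′ , S′! , k∉S′ , S′⊆S , sumS≡ ← Unique-remove p S! k∈S =
  inj₂ (_ , trans (sym sumS≡) sum≡ ,
        S′ , S′! , All<suc∧∉⇒All< (anti-mono S′⊆S S<1+k) k∉S′ , refl)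

pValues : ℕ → List ℕ
pValues k = map p (downFrom k)

representableBelow⇒≤sum : ∀ k {n} → RepresentableBelow k n → n ≤ sum (pValues k)
representableBelow⇒≤sum zero ([] , _ , [] , refl) = z≤n
representableBelow⇒≤sum (suc k) r with representableBelow-suc⁻ r
... | inj₁ r′ = ≤-trans (representableBelow⇒≤sum k r′) (m≤n+m _ (p k))
... | inj₂ (_ , refl , r′) = +-monoʳ-≤ (p k) (representableBelow⇒≤sum k r′)

-- search vs b n decides whether n is a sum of a subfamily of vs; the extra argument
-- b is only used for pruning and must bound the sum of the values still available.
search : List ℕ → ℕ → ℕ → Bool
search [] _ n = n ≡ᵇ 0
search (v ∷ vs) b n =
  (n ≤ᵇ b) ∧ (((v ≤ᵇ n) ∧ search vs (b ∸ v) (n ∸ v)) ∨ search vs (b ∸ v) n)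

search-sound : ∀ k {b n} → T (search (pValues k) b n) → RepresentableBelow k n
search-sound zero {n = n} found = [] , [] , [] , sym (≡ᵇ⇒≡ n 0 found)
search-sound (suc k) {b} {n} found with Equivalence.to T-∨ (proj₂ (Equivalence.to T-∧ found))
... | inj₁ used with pk≤n , rest ← Equivalence.to T-∧ used =
  subst (RepresentableBelow (suc k)) (m+[n∸m]≡n (≤ᵇ⇒≤ (p k) n pk≤n))
    (representableBelow-suc⁺ (search-sound k rest))
... | inj₂ unused = representableBelow-mono (n≤1+n k) (search-sound k unused)

search-complete : ∀ k {b n} → sum (pValues k) ≤ b → RepresentableBelow k n →
  T (search (pValues k) b n)
search-complete zero _ ([] , _ , [] , refl) = _
search-complete (suc k) {b} {n} sum≤b r =
  Equivalence.from T-∧ (≤⇒≤ᵇ n≤b , Equivalence.from T-∨ found)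
  where
  n≤b : n ≤ b
  n≤b = ≤-trans (representableBelow⇒≤sum (suc k) r) sum≤b
  rest≤b∸pk : sum (pValues k) ≤ b ∸ p k
  rest≤b∸pk = subst (_≤ b ∸ p k) (m+n∸m≡n (p k) _) (∸-monoˡ-≤ (p k) sum≤b)
  found : T ((p k ≤ᵇ n) ∧ search (pValues k) (b ∸ p k) (n ∸ p k)) ⊎
          T (search (pValues k) (b ∸ p k) n)
  found with representableBelow-suc⁻ r
  ... | inj₁ r′ = inj₂ (search-complete k rest≤b∸pk r′)
  ... | inj₂ (m , refl , r′) = inj₁ (Equivalence.from T-∧ (≤⇒≤ᵇ (m≤m+n (p k) m) ,
    subst (T ∘ search (pValues k) (b ∸ p k)) (sym (m+n∸m≡n (p k) m))
      (search-complete k rest≤b∸pk r′)))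

representable⇒representableBelow : ∀ {k n} → n < p k → Representable n → RepresentableBelow k n
representable⇒representableBelow {k} {n} n<pk (S , S! , sum≡) = S , S! , All.tabulate x<k , sum≡
  where
  x<k : ∀ {x} → x ∈ S → x < k
  x<k {x} x∈S with Unique-remove p S! x∈S
  ... | _ , _ , _ , _ , sumS≡ = ≰⇒> λ k≤x → <⇒≱ n<pk (begin
    p k                ≤⟨ p-mono-≤ k≤x ⟩
    p x                ≤⟨ m≤m+n (p x) _ ⟩
    p x + _            ≡⟨ sumS≡ ⟨
    sum (map p S)      ≡⟨ sum≡ ⟩
    n                  ∎)
    where open ≤-Reasoning

IntervalRepresentable : ℕ → ℕ → Set
IntervalRepresentable M k = ∀ n → M < n → n ≤ M + p k → RepresentableBelow k n

intervalRepresentable-suc : ∀ {M k} → p (suc k) ≤ p k + p k →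
  IntervalRepresentable M k → IntervalRepresentable M (suc k)
intervalRepresentable-suc {M} {k} p[1+k]≤2p[k] covered n M<n n≤M+p[1+k] with n ≤? M + p k
... | yes n≤M+pk = representableBelow-mono (n≤1+n k) (covered n M<n n≤M+pk)
... | no n≰M+pk = subst (RepresentableBelow (suc k)) (m+[n∸m]≡n pk≤n)
  (representableBelow-suc⁺ (covered (n ∸ p k) M<n∸pk n∸pk≤M+pk))
  where
  pk≤n : p k ≤ n
  pk≤n = ≤-trans (m≤n+m (p k) M) (<⇒≤ (≰⇒> n≰M+pk))
  M<n∸pk : M < n ∸ p k
  M<n∸pk = +-cancelʳ-< (p k) M (n ∸ p k)
    (subst (M + p k <_) (sym (m∸n+n≡m pk≤n)) (≰⇒> n≰M+pk))
  n∸pk≤M+pk : n ∸ p k ≤ M + p k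
  n∸pk≤M+pk = subst (n ∸ p k ≤_) (m+n∸n≡m (M + p k) (p k)) (∸-monoˡ-≤ (p k) (begin
    n                  ≤⟨ n≤M+p[1+k] ⟩
    M + p (suc k)      ≤⟨ +-monoʳ-≤ M p[1+k]≤2p[k] ⟩
    M + (p k + p k)    ≡⟨ +-assoc M (p k) (p k) ⟨
    M + p k + p k      ∎))
    where open ≤-Reasoning

-- Checked by evaluation: the search succeeds on each n in (12659, 12659 + p 21] = [12660, 25309].
intervalRepresentable-21 : IntervalRepresentable 12659 21
intervalRepresentable-21 n 12659<n n≤25309 = search-sound 21 (All.lookup allFound n∈interval)
  where
  allFound : All (T ∘ search (pValues 21) (sum (pValues 21))) (applyDownFrom (12660 +_) 12650)
  allFound = toWitness {a? = all? (T? ∘ search (pValues 21) (sum (pValues 21))) _} _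
  n∈interval : n ∈ applyDownFrom (12660 +_) 12650
  n∈interval = applyDownFrom⁺ (12660 +_) {n ∸ 12660} {12650}
    (sym (m+[n∸m]≡n 12659<n)) (s≤s (∸-monoˡ-≤ 12660 n≤25309))

intervalRepresentable-+ : ∀ {M k₀} → (∀ {k} → k₀ ≤ k → p (suc k) ≤ p k + p k) →
  IntervalRepresentable M k₀ → ∀ i → IntervalRepresentable M (i + k₀)
intervalRepresentable-+ doubling covered zero = covered
intervalRepresentable-+ {k₀ = k₀} doubling covered (suc i) =
  intervalRepresentable-suc (doubling (m≤n+m k₀ i)) (intervalRepresentable-+ doubling covered i)

mainTheorem1 : (¬ Representable 12659) × ((n : ℕ) → n > 12659 → Representable n)
mainTheorem1 = 12659-notRepresentable , >12659-representable
  where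
  12659-notRepresentable : ¬ Representable 12659
  -- the search for 12659 among the p j with j < 22 evaluates to false
  12659-notRepresentable r =
    search-complete 22 ≤-refl (representable⇒representableBelow (<ᵇ⇒< 12659 (p 22) _) r)
  >12659-representable : (n : ℕ) → n > 12659 → Representable n
  >12659-representable n 12659<n = representableBelow⇒representable
    (intervalRepresentable-+ (p[1+k]≤p[k]+p[k] ∘ ≤-trans 3≤21) intervalRepresentable-21
      n n 12659<n
      (≤-trans (m≤m+n n 21) (≤-trans (n≤p[n] (n + 21)) (m≤n+m _ 12659))))
    where
    3≤21 : 3 ≤ 21
    3≤21 = s≤s (s≤s (s≤s z≤n))
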